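{- Let $m\ge2$, $\mathcal A=\mathbb Z_m$, and let $\mathbf u\in\mathcal A^{\mathbb N}$ be closed under all elements of $I_2(m)$. Suppose that for every factor $u_0u_1u_2u_3$ of $\mathbf u$ of length $4$ one has $u_i-u_{i-1}\equiv1\pmod m$ for at least two indices $i\in\{1,2,3\}$. If $\mathbf u$ is $I_2(m)$-rich, then $S(\mathbf u)$ is almost $I_2'(m)$-rich.
   Context: Letter arithmetic is modulo $m$. $S(w_0w_1\cdots)=v_1v_2\cdots$ with $v_i=(w_{i-1}+w_i)\bmod m$. For $x\in\mathbb Z_m$, $\Psi_x$ is the antimorphism with $\Psi_x(k)=x-k$ on letters and $\Pi_x$ the morphism with $\Pi_x(k)=x+k$. $I_2(m)=\{\Psi_x,\Pi_x: x\in\mathbb Z_m\}$ and $I_2'(m)=\{\Psi_{2x},\Pi_{2x}:x\in\mathbb Z_m\}$. $\mathbf u$ is closed under a group $G$ if $\mu(w)$ is a factor of $\mathbf u$ for all factors $w$ and $\mu\in G$. For such a group $G$: orbit $[w]=\{\mu(w):\mu\in G\}$; $p$ is a $G$-palindrome if $\Psi(p)=p$ for some antimorphism $\Psi\in G$; for a finite word $w$, $\mathrm{Pal}^G(w)$ is the set of orbits $[p]$ of $G$-palindromic factors $p$ of $w$ (empty word included), $\gamma_G(w)$ the number of orbits $[a]$ of letters $a$ occurring in $w$ with $a\ne\Psi(a)$ for all antimorphisms $\Psi\in G$, and $D^G(w)=|w|+1-\#\mathrm{Pal}^G(w)-\gamma_G(w)$; $D^G(\mathbf u)$ is the supremum over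 factors. $G$-rich means $D^G(\mathbf u)=0$, almost $G$-rich means $D^G(\mathbf u)<\infty$. -}

module Defs where

open import Data.Nat using (ℕ; zero; suc; _+_; _*_; _∸_; NonZero)
open import Data.Nat.DivMod using (_mod_)
open import Data.Fin using (Fin; toℕ)
open import Data.List using (List; []; _∷_; map; reverse; length; _++_; upTo)
open import Data.List.Membership.Propositional using (_∈_)
open import Data.Vec.Functional using (Vector)
open import Data.Integer as ℤ using (ℤ; +_)
open import Data.Product using (Σ; ∃; _×_; _,_)
open import Data.Sum using (_⊎_)
open import Data.Unit using (⊤)
open import Data.Empty using (⊥)
open import Relation.Binary.PropositionalEquality using (_≡_; _≢_)

module Z (m : ℕ) .{{_ : NonZero m}} where

  Letter : Set
  Letter = Fin m

  Word : Set
  Word = List Letter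

  InfWord : Set
  InfWord = ℕ → Letter

  _⊕_ : Letter → Letter → Letter
  a ⊕ b = (toℕ a + toℕ b) mod m

  _⊖_ : Letter → Letter → Letter
  a ⊖ b = (toℕ a + (m ∸ toℕ b)) mod m

  one : Letter
  one = 1 mod m

  -- the (second-order) sum operator: S(u)_n = u_n + u_{n+1}, i.e. v_i = u_{i-1} + u_i
  S : InfWord → InfWord
  S u n = u n ⊕ u (suc n)

  data Sym : Set where
    Ψ : Letter → Sym
    Π : Letter → Sym

  apply : Sym → Word → Word
  apply (Ψ x) w = reverse (map (x ⊖_) w)
  apply (Π x) w = map (x ⊕_) w

  IsAnti : Sym → Set
  IsAnti (Ψ _) = ⊤
  IsAnti (Π _) = ⊥

  Grp : Set₁
  Grp = Sym → Set

  I₂ : Grp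
  I₂ _ = ⊤

  IsDouble : Letter → Set
  IsDouble x = ∃ λ (y : Letter) → x ≡ (2 * toℕ y) mod m

  I₂' : Grp
  I₂' (Ψ x) = IsDouble x
  I₂' (Π x) = IsDouble x

  factorAt : InfWord → ℕ → ℕ → Word
  factorAt u i n = map (λ j → u (i + j)) (upTo n)

  IsFactor : InfWord → Word → Set
  IsFactor u w = ∃ λ i → w ≡ factorAt u i (length w)

  _⊑_ : Word → Word → Set
  p ⊑ w = ∃ λ xs → ∃ λ ys → w ≡ xs ++ p ++ ys

  ClosedUnder : Grp → InfWord → Set
  ClosedUnder G u = ∀ μ → G μ → ∀ w → IsFactor u w → IsFactor u (apply μ w)

  SameOrbit : Grp → Word → Word → Set
  SameOrbit G v w = ∃ λ μ → G μ × apply μ v ≡ w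

  IsGPal : Grp → Word → Set
  IsGPal G p = ∃ λ μ → G μ × IsAnti μ × apply μ p ≡ p

  OrbitCount : Grp → (Word → Set) → ℕ → Set
  OrbitCount G P n = Σ (Vector Word n) λ reps →
      (∀ i → P (reps i))
    × (∀ i j → SameOrbit G (reps i) (reps j) → i ≡ j)
    × (∀ p → P p → ∃ λ i → SameOrbit G (reps i) p)

  -- G-palindromic factors of w (empty word included)
  PalFactor : Grp → Word → Word → Set
  PalFactor G w p = p ⊑ w × IsGPal G p

  GammaLetter : Grp → Word → Word → Set
  GammaLetter G w v = ∃ λ a → v ≡ a ∷ []
    × a ∈ w
    × (∀ μ → G μ → IsAnti μ → apply μ (a ∷ []) ≢ a ∷ [])

  Dvalue : Word → ℕ → ℕ → ℤ
  Dvalue w npal γ = + (length w + 1) ℤ.- + npal ℤ.- + γ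

  HasDefect : Grp → Word → ℤ → Set
  HasDefect G w d = ∃ λ npal → ∃ λ γ →
    OrbitCount G (PalFactor G w) npal × OrbitCount G (GammaLetter G w) γ
    × d ≡ Dvalue w npal γ

  -- G-rich: D^G(u) = sup = 0; the empty factor has defect 0, so this is: all defects ≤ 0
  Rich : Grp → InfWord → Set
  Rich G u = ∀ w → IsFactor u w → ∀ d → HasDefect G w d → d ℤ.≤ + 0

  AlmostRich : Grp → InfWord → Set
  AlmostRich G u = ∃ λ (B : ℕ) → ∀ w → IsFactor u w → ∀ d → HasDefect G w d → d ℤ.≤ + B

  Step : InfWord → ℕ → Set
  Step u k = u (suc k) ≡ u k ⊕ one

  TwoSteps : InfWord → Set
  TwoSteps u = ∀ i → (Step u i × Step u (suc i))
                   ⊎ (Step u i × Step u (suc (suc i)))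
                   ⊎ (Step u (suc i) × Step u (suc (suc i)))

-- Let w be a factor of u of length n + 1 and v = S(w).  Every letter a is fixed by Ψ_{2a}, so
-- richness of u gives w at least n + 2 orbits of I₂(m)-palindromic factors.  S turns a
-- Ψ_c-palindrome into a Ψ_{2c}-palindrome and intertwines I₂(m) with I₂'(m), so it sends these
-- orbits to orbits of I₂'(m)-palindromic factors of v.  On palindromes of length ≥ 4 this is
-- injective: after moving p and q by symmetries we get factors of u with the same S-image, and the
-- step hypothesis gives both a common position where they increase by 1, which forces q = Π_t(p).
-- The shorter palindromes fall into at most (m + 1)³ orbits, hence D^{I₂'}(v) ≤ (m + 1)³.

module Submission where

open import Defs

open import Algebra.Bundles using (AbelianGroup)
open import Algebra.Structures using (IsAbelianGroup)
import Algebra.Properties.AbelianGroup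
import Algebra.Properties.CommutativeSemigroup
open import Data.Empty using (⊥-elim)
open import Data.Fin using (Fin; toℕ; join; splitAt; combine) renaming (zero to fzero; suc to fsuc)
open import Data.Fin.Properties
  using (toℕ-injective; toℕ-fromℕ<; toℕ<n; any?; injective⇒≤; splitAt-join; combine-injective; suc-injective)
  renaming (_≟_ to _≟ᶠ_)
open import Data.Integer using (+_)
import Data.Integer.Base as ℤ
import Data.Integer.Properties as ℤ
open import Data.List using (List; []; _∷_; map; reverse; length; _++_; _∷ʳ_; applyUpTo; upTo; lookup; drop)
open import Data.List.Properties
  using ( map-upTo; length-upTo; map-applyUpTo; ≡-dec; ∷-injectiveˡ; ∷-injectiveʳ; map-cong; map-∘; map-id
        ; reverse-map; reverse-involutive; unfold-reverse; length-map; length-reverse)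
open import Data.List.Membership.Propositional using (_∈_)
open import Data.List.Membership.Propositional.Properties using (∈-map⁺; ∈-map⁻; ∈-++⁺ˡ; ∈-++⁺ʳ; ∈-++⁻; ∈-lookup)
import Data.List.Membership.DecPropositional
open import Data.List.Relation.Unary.All using (All; []; _∷_)
import Data.List.Relation.Unary.All as All
open import Data.List.Relation.Unary.Any using (Any; here; there)
import Data.List.Relation.Unary.Any as Any
open import Data.List.Relation.Unary.Any.Properties using (lookup-index)
open import Data.Nat using (ℕ; zero; suc; _+_; _*_; _∸_; _%_; _≤_; _<_; _≤?_; s≤s; z≤n; NonZero)
open import Data.Nat.DivMod using (_mod_; m%n<n; m<n⇒m%n≡m; %-distribˡ-+; [m+n]%n≡m%n)
open import Data.Nat.Properties
  using (+-comm; +-assoc; +-suc; +-identityʳ; m∸n+n≡m; m≤m+n; m+n∸m≡n; <⇒≤; ≰⇒>; ≤-trans; module ≤-Reasoning)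
open import Data.Product using (Σ; ∃; _×_; _,_; proj₁; proj₂; map₂)
open import Data.Sum using (_⊎_; inj₁; inj₂)
open import Data.Sum.Properties using (inj₁-injective; inj₂-injective)
open import Data.Unit using (tt)
open import Data.Vec.Functional using (Vector)
open import Function using (_∘_)
open import Level using (0ℓ)
open import Relation.Binary.PropositionalEquality
open import Relation.Binary.Structures using (IsDecEquivalence)
open import Relation.Nullary using (Dec; yes; no; ¬_)
open import Relation.Nullary.Decidable using (map′; _×-dec_)
open import Relation.Unary using (Decidable)

module _ {A : Set} where

  applyUpTo-cong : ∀ {f g : ℕ → A} n → (∀ {j} → j < n → f j ≡ g j) → applyUpTo f n ≡ applyUpTo g n
  applyUpTo-cong zero    f≡g = refl
  applyUpTo-cong (suc n) f≡g = cong₂ _∷_ (f≡g (s≤s z≤n)) (applyUpTo-cong n (λ j<n → f≡g (s≤s j<n)))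

  applyUpTo-injective : ∀ {f g : ℕ → A} n → applyUpTo f n ≡ applyUpTo g n → ∀ {j} → j < n → f j ≡ g j
  applyUpTo-injective (suc n) eq {zero}  _         = ∷-injectiveˡ eq
  applyUpTo-injective (suc n) eq {suc j} (s≤s j<n) = applyUpTo-injective n (∷-injectiveʳ eq) j<n

  applyUpTo-infix : ∀ (f : ℕ → A) n xs p ys → xs ++ p ++ ys ≡ applyUpTo f n →
                    p ≡ applyUpTo (λ j → f (length xs + j)) (length p)
  applyUpTo-infix f n       []       []      ys eq = refl
  applyUpTo-infix f zero    []       (a ∷ p) ys ()
  applyUpTo-infix f (suc n) []       (a ∷ p) ys eq =
    cong₂ _∷_ (∷-injectiveˡ eq) (applyUpTo-infix (f ∘ suc) n [] p ys (∷-injectiveʳ eq))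
  applyUpTo-infix f zero    (x ∷ xs) p       ys ()
  applyUpTo-infix f (suc n) (x ∷ xs) p       ys eq = applyUpTo-infix (f ∘ suc) n xs p ys (∷-injectiveʳ eq)

  prefixes : List A → List (List A)
  prefixes []      = [] ∷ []
  prefixes (a ∷ w) = [] ∷ map (a ∷_) (prefixes w)

  infixes : List A → List (List A)
  infixes []      = [] ∷ []
  infixes (a ∷ w) = prefixes (a ∷ w) ++ infixes w

  ∈-prefixes⁺ : ∀ p ys → p ∈ prefixes (p ++ ys)
  ∈-prefixes⁺ []      []      = here refl
  ∈-prefixes⁺ []      (_ ∷ _) = here refl
  ∈-prefixes⁺ (a ∷ p) ys      = there (∈-map⁺ (a ∷_) (∈-prefixes⁺ p ys))

  ∈-prefixes⁻ : ∀ {p} w → p ∈ prefixes w → ∃ λ ys → w ≡ p ++ ys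
  ∈-prefixes⁻ []      (here refl) = [] , refl
  ∈-prefixes⁻ (a ∷ w) (here refl) = a ∷ w , refl
  ∈-prefixes⁻ (a ∷ w) (there p∈)  with ∈-map⁻ (a ∷_) p∈
  ... | q , q∈ , refl = map₂ (cong (a ∷_)) (∈-prefixes⁻ w q∈)

  ∈-infixes⁺ : ∀ xs p ys → p ∈ infixes (xs ++ p ++ ys)
  ∈-infixes⁺ []       []      []      = here refl
  ∈-infixes⁺ []       []      (_ ∷ _) = here refl
  ∈-infixes⁺ []       (a ∷ p) ys      = ∈-++⁺ˡ (∈-prefixes⁺ (a ∷ p) ys)
  ∈-infixes⁺ (x ∷ xs) p       ys      = ∈-++⁺ʳ (prefixes (x ∷ xs ++ p ++ ys)) (∈-infixes⁺ xs p ys)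

  ∈-infixes⁻ : ∀ {p} w → p ∈ infixes w → ∃ λ xs → ∃ λ ys → w ≡ xs ++ p ++ ys
  ∈-infixes⁻ []      (here refl) = [] , [] , refl
  ∈-infixes⁻ (a ∷ w) p∈          with ∈-++⁻ (prefixes (a ∷ w)) p∈
  ... | inj₁ p∈pre = [] , ∈-prefixes⁻ (a ∷ w) p∈pre
  ... | inj₂ p∈inf with ∈-infixes⁻ w p∈inf
  ...   | xs , ys , eq = a ∷ xs , ys , cong (a ∷_) eq

propagate : ∀ {Q : ℕ → Set} n → (∀ {j} → j < n → Q j → Q (suc j)) → (∀ {j} → j < n → Q (suc j) → Q j) →
            ∀ {i j} → i ≤ n → j ≤ n → Q i → Q j
propagate {Q} n forward backward i≤n j≤n = up j≤n ∘ down i≤n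
  where
  down : ∀ {i} → i ≤ n → Q i → Q 0
  down {zero}  _   q = q
  down {suc i} i<n q = down (<⇒≤ i<n) (backward i<n q)
  up : ∀ {j} → j ≤ n → Q 0 → Q j
  up {zero}  _   q = q
  up {suc j} j<n q = forward j<n (up (<⇒≤ j<n) q)

module _ {A : Set} {_∼_ : A → A → Set} (∼-isDecEquivalence : IsDecEquivalence _∼_) where
  open IsDecEquivalence ∼-isDecEquivalence renaming (refl to ∼-refl; sym to ∼-sym; _≟_ to _∼?_)

  private
    Distinct : List A → Set
    Distinct K = ∀ i j → lookup K i ∼ lookup K j → i ≡ j

    lookup-Any : ∀ {Q : A → Set} K i → Q (lookup K i) → Any Q K
    lookup-Any K i q = Any.map (λ eq → subst _ eq q) (∈-lookup i)

    Distinct-∷ : ∀ {c K} → ¬ Any (_∼ c) K → Distinct K → Distinct (c ∷ K)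
    Distinct-∷         c∉K distinct fzero    fzero    _ = refl
    Distinct-∷ {K = K} c∉K distinct fzero    (fsuc j) r = ⊥-elim (c∉K (lookup-Any K j (∼-sym r)))
    Distinct-∷ {K = K} c∉K distinct (fsuc i) fzero    r = ⊥-elim (c∉K (lookup-Any K i r))
    Distinct-∷         c∉K distinct (fsuc i) (fsuc j) r = cong fsuc (distinct i j r)

    representatives : ∀ {P : A → Set} → Decidable P → ∀ L →
                      ∃ λ K → All P K × Distinct K × (∀ {p} → p ∈ L → P p → Any (_∼ p) K)
    representatives P? [] = [] , [] , (λ ()) , (λ ())
    representatives P? (c ∷ L) with representatives P? L
    ... | K , allP , distinct , covers with P? c | Any.any? (_∼? c) K
    ...   | no ¬Pc | _       = K , allP , distinct , λ { (here refl) Pc → ⊥-elim (¬Pc Pc) ; (there p∈) → covers p∈ }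
    ...   | yes Pc | yes c∈K = K , allP , distinct , λ { (here refl) _ → c∈K ; (there p∈) → covers p∈ }
    ...   | yes Pc | no c∉K  = c ∷ K , Pc ∷ allP , Distinct-∷ c∉K distinct ,
                               λ { (here refl) _ → here ∼-refl ; (there p∈) Pp → there (covers p∈ Pp) }

  countClasses : ∀ {P : A → Set} → Decidable P → ∀ L → (∀ {p} → P p → p ∈ L) →
                 ∃ λ n → Σ (Vector A n) λ reps → (∀ i → P (reps i))
                   × (∀ i j → reps i ∼ reps j → i ≡ j) × (∀ p → P p → ∃ λ i → reps i ∼ p)
  countClasses P? L complete with representatives P? L
  ... | K , allP , distinct , covers =
    length K , lookup K , (λ i → All.lookup allP (∈-lookup i)) , distinct ,
    λ p Pp → Any.index (covers (complete Pp) Pp) , lookup-index (covers (complete Pp) Pp)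

⊎-injective⇒≤ : ∀ {n k c} (f : Fin n → Fin k ⊎ Fin c) → (∀ {i j} → f i ≡ f j → i ≡ j) → n ≤ k + c
⊎-injective⇒≤ {k = k} {c} f f-injective = injective⇒≤ {f = join k c ∘ f} λ {i} {j} eq →
  f-injective (trans (sym (splitAt-join k c (f i))) (trans (cong (splitAt k) eq) (splitAt-join k c (f j))))

m-n-0≤0⇒m≤n : ∀ a n → + a ℤ.- + n ℤ.- + 0 ℤ.≤ + 0 → a ≤ n
m-n-0≤0⇒m≤n a n le = ℤ.drop‿+≤+ (ℤ.i-j≤0⇒i≤j (subst (ℤ._≤ + 0) (ℤ.+-identityʳ (+ a ℤ.- + n)) le))

m≤n+o⇒m-n-k≤o : ∀ a n o k → a ≤ n + o → + a ℤ.- + n ℤ.- + k ℤ.≤ + o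
m≤n+o⇒m-n-k≤o a n o k a≤n+o = ℤ.≤-trans (ℤ.i-j≤i (+ a ℤ.- + n) (+ k)) (begin
  + a ℤ.- + n     ≡⟨ ℤ.m-n≡m⊖n a n ⟩
  a ℤ.⊖ n         ≤⟨ ℤ.⊖-monoˡ-≤ n a≤n+o ⟩
  (n + o) ℤ.⊖ n   ≡⟨ ℤ.⊖-≥ (m≤m+n n o) ⟩
  + (n + o ∸ n)   ≡⟨ cong +_ (m+n∸m≡n n o) ⟩
  + o             ∎)
  where open ℤ.≤-Reasoning

module Letters (m : ℕ) .{{_ : NonZero m}} where
  open Z m
  open ≡-Reasoning

  toℕ-mod : ∀ x → toℕ (x mod m) ≡ x % m
  toℕ-mod x = toℕ-fromℕ< (m%n<n x m)

  mod-cong : ∀ {x y} → x % m ≡ y % m → x mod m ≡ y mod m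
  mod-cong {x} {y} e = toℕ-injective (trans (toℕ-mod x) (trans e (sym (toℕ-mod y))))

  mod-toℕ : ∀ a → toℕ a mod m ≡ a
  mod-toℕ a = toℕ-injective (trans (toℕ-mod (toℕ a)) (m<n⇒m%n≡m (toℕ<n a)))

  mod-⊕ : ∀ x y → (x mod m) ⊕ (y mod m) ≡ (x + y) mod m
  mod-⊕ x y = mod-cong (begin
    (toℕ (x mod m) + toℕ (y mod m)) % m  ≡⟨ cong₂ (λ p q → (p + q) % m) (toℕ-mod x) (toℕ-mod y) ⟩
    (x % m + y % m) % m                  ≡⟨ %-distribˡ-+ x y m ⟨
    (x + y) % m                          ∎)

  zeroₘ : Letter
  zeroₘ = 0 mod m

  negₘ : Letter → Letter
  negₘ a = (m ∸ toℕ a) mod m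

  ⊕-comm : ∀ a b → a ⊕ b ≡ b ⊕ a
  ⊕-comm a b = cong (_mod m) (+-comm (toℕ a) (toℕ b))

  ⊕-assoc : ∀ a b c → (a ⊕ b) ⊕ c ≡ a ⊕ (b ⊕ c)
  ⊕-assoc a b c = begin
    (a ⊕ b) ⊕ c                      ≡⟨ cong ((a ⊕ b) ⊕_) (mod-toℕ c) ⟨
    (a ⊕ b) ⊕ (toℕ c mod m)          ≡⟨ mod-⊕ (toℕ a + toℕ b) (toℕ c) ⟩
    (toℕ a + toℕ b + toℕ c) mod m    ≡⟨ cong (_mod m) (+-assoc (toℕ a) (toℕ b) (toℕ c)) ⟩
    (toℕ a + (toℕ b + toℕ c)) mod m  ≡⟨ mod-⊕ (toℕ a) (toℕ b + toℕ c) ⟨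
    (toℕ a mod m) ⊕ (b ⊕ c)          ≡⟨ cong (_⊕ (b ⊕ c)) (mod-toℕ a) ⟩
    a ⊕ (b ⊕ c)                      ∎

  ⊕-identityˡ : ∀ a → zeroₘ ⊕ a ≡ a
  ⊕-identityˡ a = begin
    zeroₘ ⊕ a              ≡⟨ cong (zeroₘ ⊕_) (mod-toℕ a) ⟨
    zeroₘ ⊕ (toℕ a mod m)  ≡⟨ mod-⊕ 0 (toℕ a) ⟩
    toℕ a mod m            ≡⟨ mod-toℕ a ⟩
    a                      ∎

  negₘ-inverseˡ : ∀ a → negₘ a ⊕ a ≡ zeroₘ
  negₘ-inverseˡ a = begin
    negₘ a ⊕ a                 ≡⟨ cong (negₘ a ⊕_) (mod-toℕ a) ⟨
    negₘ a ⊕ (toℕ a mod m)     ≡⟨ mod-⊕ (m ∸ toℕ a) (toℕ a) ⟩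
    (m ∸ toℕ a + toℕ a) mod m  ≡⟨ cong (_mod m) (m∸n+n≡m (<⇒≤ (toℕ<n a))) ⟩
    m mod m                    ≡⟨ mod-cong ([m+n]%n≡m%n 0 m) ⟩
    zeroₘ                      ∎

  ⊕-isAbelianGroup : IsAbelianGroup _≡_ _⊕_ zeroₘ negₘ
  ⊕-isAbelianGroup = record
    { isGroup = record
      { isMonoid = record
        { isSemigroup = record
          { isMagma = record { isEquivalence = isEquivalence ; ∙-cong = cong₂ _⊕_ }
          ; assoc = ⊕-assoc }
        ; identity = ⊕-identityˡ , λ a → trans (⊕-comm a zeroₘ) (⊕-identityˡ a) }
      ; inverse = negₘ-inverseˡ , λ a → trans (⊕-comm a (negₘ a)) (negₘ-inverseˡ a)
      ; ⁻¹-cong = cong negₘ }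
    ; comm = ⊕-comm }

  ℤₘ : AbelianGroup 0ℓ 0ℓ
  ℤₘ = record { isAbelianGroup = ⊕-isAbelianGroup }

  open AbelianGroup ℤₘ using (commutativeSemigroup)
  open AbelianGroup ℤₘ public using () renaming (identityʳ to ⊕-identityʳ; inverseʳ to negₘ-inverseʳ)
  open Algebra.Properties.AbelianGroup ℤₘ public using (⁻¹-∙-comm; ⁻¹-involutive; ∙-cancelˡ; ∙-cancelʳ)
  open Algebra.Properties.CommutativeSemigroup commutativeSemigroup public using (interchange)

  ⊖-as-⊕ : ∀ a b → a ⊖ b ≡ a ⊕ negₘ b
  ⊖-as-⊕ a b = begin
    a ⊖ b                   ≡⟨ mod-⊕ (toℕ a) (m ∸ toℕ b) ⟨
    (toℕ a mod m) ⊕ negₘ b  ≡⟨ cong (_⊕ negₘ b) (mod-toℕ a) ⟩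
    a ⊕ negₘ b              ∎

  double-mod : ∀ a → (2 * toℕ a) mod m ≡ a ⊕ a
  double-mod a = cong (λ n → (toℕ a + n) mod m) (+-identityʳ (toℕ a))

  ⊖-⊕-cancel : ∀ a b → (a ⊖ b) ⊕ b ≡ a
  ⊖-⊕-cancel a b = begin
    (a ⊖ b) ⊕ b           ≡⟨ cong (_⊕ b) (⊖-as-⊕ a b) ⟩
    (a ⊕ negₘ b) ⊕ b      ≡⟨ ⊕-assoc a (negₘ b) b ⟩
    a ⊕ (negₘ b ⊕ b)      ≡⟨ cong (a ⊕_) (negₘ-inverseˡ b) ⟩
    a ⊕ zeroₘ             ≡⟨ ⊕-identityʳ a ⟩
    a                     ∎

  ⊕-⊖-assoc : ∀ a b x → (a ⊕ b) ⊖ x ≡ a ⊕ (b ⊖ x)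
  ⊕-⊖-assoc a b x = begin
    (a ⊕ b) ⊖ x           ≡⟨ ⊖-as-⊕ (a ⊕ b) x ⟩
    (a ⊕ b) ⊕ negₘ x      ≡⟨ ⊕-assoc a b (negₘ x) ⟩
    a ⊕ (b ⊕ negₘ x)      ≡⟨ cong (a ⊕_) (⊖-as-⊕ b x) ⟨
    a ⊕ (b ⊖ x)           ∎

  ⊖-⊕ : ∀ a b x → a ⊖ (b ⊕ x) ≡ (a ⊖ b) ⊖ x
  ⊖-⊕ a b x = begin
    a ⊖ (b ⊕ x)               ≡⟨ ⊖-as-⊕ a (b ⊕ x) ⟩
    a ⊕ negₘ (b ⊕ x)          ≡⟨ cong (a ⊕_) (⁻¹-∙-comm b x) ⟨
    a ⊕ (negₘ b ⊕ negₘ x)     ≡⟨ ⊕-assoc a (negₘ b) (negₘ x) ⟨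
    (a ⊕ negₘ b) ⊕ negₘ x     ≡⟨ cong (λ y → y ⊕ negₘ x) (⊖-as-⊕ a b) ⟨
    (a ⊖ b) ⊕ negₘ x          ≡⟨ ⊖-as-⊕ (a ⊖ b) x ⟨
    (a ⊖ b) ⊖ x               ∎

  ⊖-⊖ : ∀ a b x → a ⊖ (b ⊖ x) ≡ (a ⊖ b) ⊕ x
  ⊖-⊖ a b x = begin
    a ⊖ (b ⊖ x)                   ≡⟨ ⊖-as-⊕ a (b ⊖ x) ⟩
    a ⊕ negₘ (b ⊖ x)              ≡⟨ cong (λ y → a ⊕ negₘ y) (⊖-as-⊕ b x) ⟩
    a ⊕ negₘ (b ⊕ negₘ x)         ≡⟨ cong (a ⊕_) (⁻¹-∙-comm b (negₘ x)) ⟨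
    a ⊕ (negₘ b ⊕ negₘ (negₘ x))  ≡⟨ cong (λ y → a ⊕ (negₘ b ⊕ y)) (⁻¹-involutive x) ⟩
    a ⊕ (negₘ b ⊕ x)              ≡⟨ ⊕-assoc a (negₘ b) x ⟨
    (a ⊕ negₘ b) ⊕ x              ≡⟨ cong (_⊕ x) (⊖-as-⊕ a b) ⟨
    (a ⊖ b) ⊕ x                   ∎

  ⊖-self : ∀ a → a ⊖ a ≡ zeroₘ
  ⊖-self a = trans (⊖-as-⊕ a a) (negₘ-inverseʳ a)

  double-⊖ : ∀ a → (a ⊕ a) ⊖ a ≡ a
  double-⊖ a = begin
    (a ⊕ a) ⊖ a     ≡⟨ ⊕-⊖-assoc a a a ⟩
    a ⊕ (a ⊖ a)     ≡⟨ cong (a ⊕_) (⊖-self a) ⟩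
    a ⊕ zeroₘ       ≡⟨ ⊕-identityʳ a ⟩
    a               ∎

  ⊖-⊕-⊖ : ∀ c a b → (c ⊖ a) ⊕ (c ⊖ b) ≡ (c ⊕ c) ⊖ (a ⊕ b)
  ⊖-⊕-⊖ c a b = begin
    (c ⊖ a) ⊕ (c ⊖ b)                 ≡⟨ cong₂ _⊕_ (⊖-as-⊕ c a) (⊖-as-⊕ c b) ⟩
    (c ⊕ negₘ a) ⊕ (c ⊕ negₘ b)       ≡⟨ interchange c (negₘ a) c (negₘ b) ⟩
    (c ⊕ c) ⊕ (negₘ a ⊕ negₘ b)       ≡⟨ cong ((c ⊕ c) ⊕_) (⁻¹-∙-comm a b) ⟩
    (c ⊕ c) ⊕ negₘ (a ⊕ b)            ≡⟨ ⊖-as-⊕ (c ⊕ c) (a ⊕ b) ⟨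
    (c ⊕ c) ⊖ (a ⊕ b)                 ∎

module Symmetries (m : ℕ) .{{_ : NonZero m}} where
  open Z m
  open ≡-Reasoning
  open Letters m

  infixr 9 _∘ₛ_
  _∘ₛ_ : Sym → Sym → Sym
  Π a ∘ₛ Π b = Π (a ⊕ b)
  Π a ∘ₛ Ψ b = Ψ (a ⊕ b)
  Ψ a ∘ₛ Π b = Ψ (a ⊖ b)
  Ψ a ∘ₛ Ψ b = Π (a ⊖ b)

  apply-∘ₛ : ∀ μ ν w → apply (μ ∘ₛ ν) w ≡ apply μ (apply ν w)
  apply-∘ₛ (Π a) (Π b) w = trans (map-cong (⊕-assoc a b) w) (map-∘ w)
  apply-∘ₛ (Π a) (Ψ b) w = begin
    reverse (map ((a ⊕ b) ⊖_) w)             ≡⟨ cong reverse (map-cong (⊕-⊖-assoc a b) w) ⟩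
    reverse (map (λ x → a ⊕ (b ⊖ x)) w)      ≡⟨ cong reverse (map-∘ w) ⟩
    reverse (map (a ⊕_) (map (b ⊖_) w))      ≡⟨ reverse-map (a ⊕_) (map (b ⊖_) w) ⟨
    map (a ⊕_) (reverse (map (b ⊖_) w))      ∎
  apply-∘ₛ (Ψ a) (Π b) w =
    cong reverse (trans (map-cong (λ x → sym (⊖-⊕ a b x)) w) (map-∘ w))
  apply-∘ₛ (Ψ a) (Ψ b) w = begin
    map ((a ⊖ b) ⊕_) w                                  ≡⟨ map-cong (λ x → sym (⊖-⊖ a b x)) w ⟩
    map (λ x → a ⊖ (b ⊖ x)) w                           ≡⟨ map-∘ w ⟩
    map (a ⊖_) (map (b ⊖_) w)                           ≡⟨ reverse-involutive _ ⟨
    reverse (reverse (map (a ⊖_) (map (b ⊖_) w)))       ≡⟨ cong reverse (reverse-map (a ⊖_) (map (b ⊖_) w)) ⟨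
    reverse (map (a ⊖_) (reverse (map (b ⊖_) w)))       ∎

  infix 10 _⁻¹ₛ
  _⁻¹ₛ : Sym → Sym
  Π a ⁻¹ₛ = Π (negₘ a)
  Ψ a ⁻¹ₛ = Ψ a

  ⁻¹ₛ-inverseˡ : ∀ μ → μ ⁻¹ₛ ∘ₛ μ ≡ Π zeroₘ
  ⁻¹ₛ-inverseˡ (Π a) = cong Π (negₘ-inverseˡ a)
  ⁻¹ₛ-inverseˡ (Ψ a) = cong Π (⊖-self a)

  apply-Π-zero : ∀ w → apply (Π zeroₘ) w ≡ w
  apply-Π-zero w = trans (map-cong ⊕-identityˡ w) (map-id w)

  apply-⁻¹ₛ : ∀ μ w → apply (μ ⁻¹ₛ) (apply μ w) ≡ w
  apply-⁻¹ₛ μ w = begin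
    apply (μ ⁻¹ₛ) (apply μ w)  ≡⟨ apply-∘ₛ (μ ⁻¹ₛ) μ w ⟨
    apply (μ ⁻¹ₛ ∘ₛ μ) w       ≡⟨ cong (λ ν → apply ν w) (⁻¹ₛ-inverseˡ μ) ⟩
    apply (Π zeroₘ) w          ≡⟨ apply-Π-zero w ⟩
    w                          ∎

  length-apply : ∀ μ w → length (apply μ w) ≡ length w
  length-apply (Π a) w = length-map (a ⊕_) w
  length-apply (Ψ a) w = trans (length-reverse (map (a ⊖_) w)) (length-map (a ⊖_) w)

  orbit-refl : ∀ w → SameOrbit I₂ w w
  orbit-refl w = Π zeroₘ , tt , apply-Π-zero w

  orbit-sym : ∀ {v w} → SameOrbit I₂ v w → SameOrbit I₂ w v
  orbit-sym (μ , _ , refl) = μ ⁻¹ₛ , tt , apply-⁻¹ₛ μ _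

  orbit-trans : ∀ {u v w} → SameOrbit I₂ u v → SameOrbit I₂ v w → SameOrbit I₂ u w
  orbit-trans (μ , _ , refl) (ν , _ , refl) = ν ∘ₛ μ , tt , apply-∘ₛ ν μ _

  _≟ʷ_ : (v w : Word) → Dec (v ≡ w)
  _≟ʷ_ = ≡-dec _≟ᶠ_

  orbit? : ∀ v w → Dec (SameOrbit I₂ v w)
  orbit? v w with any? (λ c → apply (Π c) v ≟ʷ w) | any? (λ c → apply (Ψ c) v ≟ʷ w)
  ... | yes (c , e) | _           = yes (Π c , tt , e)
  ... | no _        | yes (c , e) = yes (Ψ c , tt , e)
  ... | no ¬Π       | no ¬Ψ       = no λ { (Π c , _ , e) → ¬Π (c , e) ; (Ψ c , _ , e) → ¬Ψ (c , e) }

  orbit-isDecEquivalence : IsDecEquivalence (SameOrbit I₂)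
  orbit-isDecEquivalence = record
    { isEquivalence = record { refl = orbit-refl _ ; sym = orbit-sym ; trans = orbit-trans }
    ; _≟_ = orbit? }

  isPalindrome? : ∀ p → Dec (IsGPal I₂ p)
  isPalindrome? p = map′ (λ { (c , e) → Ψ c , tt , tt , e })
                         (λ { (Ψ c , _ , _ , e) → c , e ; (Π _ , _ , () , _) })
                         (any? (λ c → apply (Ψ c) p ≟ʷ p))

module AdjacentSums (m : ℕ) .{{_ : NonZero m}} where
  open Z m
  open ≡-Reasoning
  open Letters m
  open Symmetries m

  adjacentSums : Word → Word
  adjacentSums []          = []
  adjacentSums (_ ∷ [])    = []
  adjacentSums (a ∷ b ∷ w) = a ⊕ b ∷ adjacentSums (b ∷ w)

  length-adjacentSums : ∀ a w → length (adjacentSums (a ∷ w)) ≡ length w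
  length-adjacentSums a []      = refl
  length-adjacentSums a (b ∷ w) = cong suc (length-adjacentSums b w)

  adjacentSums-map : ∀ {f g : Letter → Letter} → (∀ a b → f a ⊕ f b ≡ g (a ⊕ b)) →
                     ∀ w → adjacentSums (map f w) ≡ map g (adjacentSums w)
  adjacentSums-map hom []          = refl
  adjacentSums-map hom (a ∷ [])    = refl
  adjacentSums-map hom (a ∷ b ∷ w) = cong₂ _∷_ (hom a b) (adjacentSums-map hom (b ∷ w))

  adjacentSums-∷ʳ : ∀ w b a → adjacentSums ((w ∷ʳ b) ∷ʳ a) ≡ adjacentSums (w ∷ʳ b) ∷ʳ (b ⊕ a)
  adjacentSums-∷ʳ []          b a = refl
  adjacentSums-∷ʳ (x ∷ [])    b a = refl
  adjacentSums-∷ʳ (x ∷ y ∷ w) b a = cong (x ⊕ y ∷_) (adjacentSums-∷ʳ (y ∷ w) b a)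

  adjacentSums-reverse : ∀ w → adjacentSums (reverse w) ≡ reverse (adjacentSums w)
  adjacentSums-reverse []          = refl
  adjacentSums-reverse (a ∷ [])    = refl
  adjacentSums-reverse (a ∷ b ∷ w) = begin
    adjacentSums (reverse (a ∷ b ∷ w))            ≡⟨ cong adjacentSums (unfold-reverse a (b ∷ w)) ⟩
    adjacentSums (reverse (b ∷ w) ∷ʳ a)           ≡⟨ cong (λ v → adjacentSums (v ∷ʳ a)) (unfold-reverse b w) ⟩
    adjacentSums ((reverse w ∷ʳ b) ∷ʳ a)          ≡⟨ adjacentSums-∷ʳ (reverse w) b a ⟩
    adjacentSums (reverse w ∷ʳ b) ∷ʳ (b ⊕ a)      ≡⟨ cong₂ _∷ʳ_ (cong adjacentSums (unfold-reverse b w)) (⊕-comm a b) ⟨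
    adjacentSums (reverse (b ∷ w)) ∷ʳ (a ⊕ b)     ≡⟨ cong (_∷ʳ (a ⊕ b)) (adjacentSums-reverse (b ∷ w)) ⟩
    reverse (adjacentSums (b ∷ w)) ∷ʳ (a ⊕ b)     ≡⟨ unfold-reverse (a ⊕ b) (adjacentSums (b ∷ w)) ⟨
    reverse (adjacentSums (a ∷ b ∷ w))            ∎

  double : Sym → Sym
  double (Π c) = Π (c ⊕ c)
  double (Ψ c) = Ψ (c ⊕ c)

  adjacentSums-apply : ∀ μ w → adjacentSums (apply μ w) ≡ apply (double μ) (adjacentSums w)
  adjacentSums-apply (Π c) w = adjacentSums-map (λ a b → interchange c a c b) w
  adjacentSums-apply (Ψ c) w = begin
    adjacentSums (reverse (map (c ⊖_) w))            ≡⟨ adjacentSums-reverse (map (c ⊖_) w) ⟩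
    reverse (adjacentSums (map (c ⊖_) w))            ≡⟨ cong reverse (adjacentSums-map (⊖-⊕-⊖ c) w) ⟩
    reverse (map ((c ⊕ c) ⊖_) (adjacentSums w))      ∎

  double-⁻¹ₛ : ∀ μ → double (μ ⁻¹ₛ) ≡ double μ ⁻¹ₛ
  double-⁻¹ₛ (Π c) = cong Π (⁻¹-∙-comm c c)
  double-⁻¹ₛ (Ψ c) = refl

  I₂'⇒double : ∀ {μ} → I₂' μ → ∃ λ ν → double ν ≡ μ
  I₂'⇒double {Π _} (c , refl) = Π c , cong Π (sym (double-mod c))
  I₂'⇒double {Ψ _} (c , refl) = Ψ c , cong Ψ (sym (double-mod c))

  adjacentSums-lift : ∀ {s w} → SameOrbit I₂' s (adjacentSums w) →
                      ∃ λ ν → adjacentSums (apply ν w) ≡ s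
  adjacentSums-lift {s} {w} (μ , μ∈I₂' , μs≡) with I₂'⇒double μ∈I₂'
  ... | ν , refl = ν ⁻¹ₛ , (begin
    adjacentSums (apply (ν ⁻¹ₛ) w)              ≡⟨ adjacentSums-apply (ν ⁻¹ₛ) w ⟩
    apply (double (ν ⁻¹ₛ)) (adjacentSums w)     ≡⟨ cong₂ apply (double-⁻¹ₛ ν) (sym μs≡) ⟩
    apply (double ν ⁻¹ₛ) (apply (double ν) s)   ≡⟨ apply-⁻¹ₛ (double ν) s ⟩
    s                                           ∎)

  adjacentSums-++ʳ : ∀ a r ys → ∃ λ Y → adjacentSums ((a ∷ r) ++ ys) ≡ adjacentSums (a ∷ r) ++ Y
  adjacentSums-++ʳ a []      ys = adjacentSums (a ∷ ys) , refl
  adjacentSums-++ʳ a (b ∷ r) ys = map₂ (cong (a ⊕ b ∷_)) (adjacentSums-++ʳ b r ys)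

  adjacentSums-++ˡ : ∀ xs a r → ∃ λ X → adjacentSums (xs ++ a ∷ r) ≡ X ++ adjacentSums (a ∷ r)
  adjacentSums-++ˡ []           a r = [] , refl
  adjacentSums-++ˡ (x ∷ [])     a r = x ⊕ a ∷ [] , refl
  adjacentSums-++ˡ (x ∷ y ∷ xs) a r with adjacentSums-++ˡ (y ∷ xs) a r
  ... | X , e = x ⊕ y ∷ X , cong (x ⊕ y ∷_) e

  adjacentSums-⊑ : ∀ {p w} → p ⊑ w → adjacentSums p ⊑ adjacentSums w
  adjacentSums-⊑ {[]}    {w} _                = [] , adjacentSums w , refl
  adjacentSums-⊑ {a ∷ r}     (xs , ys , refl) with adjacentSums-++ˡ xs a (r ++ ys) | adjacentSums-++ʳ a r ys
  ... | X , eX | Y , eY = X , Y , trans eX (cong (X ++_) eY)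

  adjacentSums-applyUpTo : ∀ (f : ℕ → Letter) n →
                           adjacentSums (applyUpTo f (suc n)) ≡ applyUpTo (λ j → f j ⊕ f (suc j)) n
  adjacentSums-applyUpTo f zero    = refl
  adjacentSums-applyUpTo f (suc n) = cong (f 0 ⊕ f 1 ∷_) (adjacentSums-applyUpTo (f ∘ suc) n)

  adjacentSums-length-injective : ∀ {v w} → 1 ≤ length v → 1 ≤ length w →
                                  length (adjacentSums v) ≡ length (adjacentSums w) → length v ≡ length w
  adjacentSums-length-injective {a ∷ v} {b ∷ w} _ _ eq =
    cong suc (trans (sym (length-adjacentSums a v)) (trans eq (length-adjacentSums b w)))

module Factors (m : ℕ) .{{_ : NonZero m}} where
  open Z m
  open ≡-Reasoning
  open AdjacentSums m

  factorAt-applyUpTo : ∀ u i n → factorAt u i n ≡ applyUpTo (λ j → u (i + j)) n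
  factorAt-applyUpTo u i n = map-upTo (λ j → u (i + j)) n

  length-factorAt : ∀ u i n → length (factorAt u i n) ≡ n
  length-factorAt u i n = trans (length-map _ (upTo n)) (length-upTo n)

  factorAt-isFactor : ∀ u i n → IsFactor u (factorAt u i n)
  factorAt-isFactor u i n = i , cong (factorAt u i) (sym (length-factorAt u i n))

  infix-isFactor : ∀ {u w p} → IsFactor u w → p ⊑ w → IsFactor u p
  infix-isFactor {u} {w} {p} (i , w≡) (xs , ys , w≡xs++p++ys) = i + length xs , (begin
    p                                                     ≡⟨ applyUpTo-infix _ (length w) xs p ys w≡window ⟩
    applyUpTo (λ j → u (i + (length xs + j))) (length p)  ≡⟨ applyUpTo-cong (length p) (λ {j} _ →
                                                               cong u (sym (+-assoc i (length xs) j))) ⟩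
    applyUpTo (λ j → u (i + length xs + j)) (length p)    ≡⟨ factorAt-applyUpTo u (i + length xs) (length p) ⟨
    factorAt u (i + length xs) (length p)                 ∎)
    where
    w≡window : xs ++ p ++ ys ≡ applyUpTo (λ j → u (i + j)) (length w)
    w≡window = trans (sym w≡xs++p++ys) (trans w≡ (factorAt-applyUpTo u i (length w)))

  adjacentSums-factorAt : ∀ u i n → adjacentSums (factorAt u i (suc n)) ≡ factorAt (S u) i n
  adjacentSums-factorAt u i n = begin
    adjacentSums (factorAt u i (suc n))                       ≡⟨ cong adjacentSums (factorAt-applyUpTo u i (suc n)) ⟩
    adjacentSums (applyUpTo (λ j → u (i + j)) (suc n))        ≡⟨ adjacentSums-applyUpTo (λ j → u (i + j)) n ⟩
    applyUpTo (λ j → u (i + j) ⊕ u (i + suc j)) n             ≡⟨ applyUpTo-cong n (λ {j} _ →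
                                                                   cong (λ k → u (i + j) ⊕ u k) (+-suc i j)) ⟩
    applyUpTo (λ j → S u (i + j)) n                           ≡⟨ factorAt-applyUpTo (S u) i n ⟨
    factorAt (S u) i n                                        ∎

  S-factor : ∀ {u v} → IsFactor (S u) v →
             ∃ λ w → IsFactor u w × length w ≡ suc (length v) × adjacentSums w ≡ v
  S-factor {u} {v} (i , v≡) = factorAt u i (suc (length v)) , factorAt-isFactor u i (suc (length v)) ,
    length-factorAt u i (suc (length v)) , trans (adjacentSums-factorAt u i (length v)) (sym v≡)

module Rigidity (m : ℕ) .{{_ : NonZero m}} where
  open Z m
  open ≡-Reasoning
  open Letters m
  open Symmetries m
  open AdjacentSums m
  open Factors m

  adjacentSums-rigid : ∀ (A B : ℕ → Letter) n {k} δ → k < n →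
                       (∀ {j} → j < n → A j ⊕ A (suc j) ≡ B j ⊕ B (suc j)) →
                       A (suc k) ≡ A k ⊕ δ → B (suc k) ≡ B k ⊕ δ →
                       ∀ {j} → j ≤ n → B j ≡ (B k ⊖ A k) ⊕ A j
  -- The differences B j ⊖ A j alternate in sign along equal adjacent sums, while the common
  -- increment δ at k makes two consecutive ones equal; so they are all equal.
  adjacentSums-rigid A B n {k} δ k<n sums≡ stepA stepB j≤n =
    propagate n forward backward (<⇒≤ k<n) j≤n B≡tA-at-k
    where
    t = B k ⊖ A k

    B≡tA-at-k : B k ≡ t ⊕ A k
    B≡tA-at-k = sym (⊖-⊕-cancel (B k) (A k))

    B≡tA-at-1+k : B (suc k) ≡ t ⊕ A (suc k)
    B≡tA-at-1+k = begin
      B (suc k)         ≡⟨ stepB ⟩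
      B k ⊕ δ           ≡⟨ cong (_⊕ δ) B≡tA-at-k ⟩
      (t ⊕ A k) ⊕ δ     ≡⟨ ⊕-assoc t (A k) δ ⟩
      t ⊕ (A k ⊕ δ)     ≡⟨ cong (t ⊕_) stepA ⟨
      t ⊕ A (suc k)     ∎

    t⊕t≡0 : t ⊕ t ≡ zeroₘ
    t⊕t≡0 = ∙-cancelʳ (A k ⊕ A (suc k)) (t ⊕ t) zeroₘ (begin
      (t ⊕ t) ⊕ (A k ⊕ A (suc k))        ≡⟨ interchange t (A k) t (A (suc k)) ⟨
      (t ⊕ A k) ⊕ (t ⊕ A (suc k))        ≡⟨ cong₂ _⊕_ B≡tA-at-k B≡tA-at-1+k ⟨
      B k ⊕ B (suc k)                    ≡⟨ sums≡ k<n ⟨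
      A k ⊕ A (suc k)                    ≡⟨ ⊕-identityˡ _ ⟨
      zeroₘ ⊕ (A k ⊕ A (suc k))          ∎)

    translated-sums : ∀ {j} → j < n → (t ⊕ A j) ⊕ (t ⊕ A (suc j)) ≡ B j ⊕ B (suc j)
    translated-sums {j} j<n = begin
      (t ⊕ A j) ⊕ (t ⊕ A (suc j))        ≡⟨ interchange t (A j) t (A (suc j)) ⟩
      (t ⊕ t) ⊕ (A j ⊕ A (suc j))        ≡⟨ cong (_⊕ (A j ⊕ A (suc j))) t⊕t≡0 ⟩
      zeroₘ ⊕ (A j ⊕ A (suc j))          ≡⟨ ⊕-identityˡ _ ⟩
      A j ⊕ A (suc j)                    ≡⟨ sums≡ j<n ⟩
      B j ⊕ B (suc j)                    ∎

    forward : ∀ {j} → j < n → B j ≡ t ⊕ A j → B (suc j) ≡ t ⊕ A (suc j)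
    forward {j} j<n eq = ∙-cancelˡ (t ⊕ A j) _ _
      (trans (cong (_⊕ B (suc j)) (sym eq)) (sym (translated-sums j<n)))

    backward : ∀ {j} → j < n → B (suc j) ≡ t ⊕ A (suc j) → B j ≡ t ⊕ A j
    backward {j} j<n eq = ∙-cancelʳ (B (suc j)) _ _
      (trans (sym (translated-sums j<n)) (cong ((t ⊕ A j) ⊕_) (sym eq)))

  -- Two 2-element subsets of {0, 1, 2} intersect.
  commonStep : ∀ {u} → TwoSteps u → ∀ i i' → ∃ λ k → k ≤ 2 × Step u (k + i) × Step u (k + i')
  commonStep twoSteps i i' with twoSteps i | twoSteps i'
  ... | inj₁ (s , _)        | inj₁ (s' , _)        = 0 , z≤n , s , s'
  ... | inj₁ (s , _)        | inj₂ (inj₁ (s' , _)) = 0 , z≤n , s , s'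
  ... | inj₁ (_ , s)        | inj₂ (inj₂ (s' , _)) = 1 , s≤s z≤n , s , s'
  ... | inj₂ (inj₁ (s , _)) | inj₁ (s' , _)        = 0 , z≤n , s , s'
  ... | inj₂ (inj₁ (s , _)) | inj₂ (inj₁ (s' , _)) = 0 , z≤n , s , s'
  ... | inj₂ (inj₁ (_ , s)) | inj₂ (inj₂ (_ , s')) = 2 , s≤s (s≤s z≤n) , s , s'
  ... | inj₂ (inj₂ (s , _)) | inj₁ (_ , s')        = 1 , s≤s z≤n , s , s'
  ... | inj₂ (inj₂ (_ , s)) | inj₂ (inj₁ (_ , s')) = 2 , s≤s (s≤s z≤n) , s , s'
  ... | inj₂ (inj₂ (s , _)) | inj₂ (inj₂ (s' , _)) = 1 , s≤s z≤n , s , s'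

  step-in-window : ∀ {u} i k → Step u (k + i) → u (i + suc k) ≡ u (i + k) ⊕ one
  step-in-window {u} i k step = trans (cong u (+-suc i k)) (subst (Step u) (+-comm k i) step)

  factorAt-rigid : ∀ {u} → TwoSteps u → ∀ i i' {L} → 4 ≤ L →
                   adjacentSums (factorAt u i L) ≡ adjacentSums (factorAt u i' L) →
                   ∃ λ t → apply (Π t) (factorAt u i L) ≡ factorAt u i' L
  factorAt-rigid {u} twoSteps i i' {suc n} (s≤s 3≤n) sums≡ with commonStep twoSteps i i'
  ... | k , k≤2 , step , step' = B k ⊖ A k , (begin
    map ((B k ⊖ A k) ⊕_) (factorAt u i (suc n))  ≡⟨ cong (map ((B k ⊖ A k) ⊕_)) (factorAt-applyUpTo u i (suc n)) ⟩
    map ((B k ⊖ A k) ⊕_) (applyUpTo A (suc n))   ≡⟨ map-applyUpTo A ((B k ⊖ A k) ⊕_) (suc n) ⟩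
    applyUpTo (λ j → (B k ⊖ A k) ⊕ A j) (suc n)  ≡⟨ applyUpTo-cong (suc n) (λ { (s≤s j≤n) → sym (rigid j≤n) }) ⟩
    applyUpTo B (suc n)                          ≡⟨ factorAt-applyUpTo u i' (suc n) ⟨
    factorAt u i' (suc n)                        ∎)
    where
    A B : ℕ → Letter
    A j = u (i + j)
    B j = u (i' + j)

    window-sums : ∀ p → adjacentSums (factorAt u p (suc n)) ≡ applyUpTo (λ j → u (p + j) ⊕ u (p + suc j)) n
    window-sums p = trans (cong adjacentSums (factorAt-applyUpTo u p (suc n))) (adjacentSums-applyUpTo (λ j → u (p + j)) n)

    pair-sums : ∀ {j} → j < n → A j ⊕ A (suc j) ≡ B j ⊕ B (suc j)
    pair-sums = applyUpTo-injective n (trans (sym (window-sums i)) (trans sums≡ (window-sums i')))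

    rigid = adjacentSums-rigid A B n one (≤-trans (s≤s k≤2) 3≤n) pair-sums
              (step-in-window {u} i k step) (step-in-window {u} i' k step')

  factors-rigid : ∀ {u a b} → TwoSteps u → IsFactor u a → IsFactor u b → length a ≡ length b → 4 ≤ length a →
                  adjacentSums a ≡ adjacentSums b → ∃ λ t → apply (Π t) a ≡ b
  factors-rigid {u} {a} {b} twoSteps (i , a≡) (i' , b≡) |a|≡|b| 4≤|a| sums≡ =
    map₂ (λ eq → trans (cong (apply (Π _)) a≡) (trans eq (sym b≡window)))
         (factorAt-rigid twoSteps i i' 4≤|a|
            (trans (cong adjacentSums (sym a≡)) (trans sums≡ (cong adjacentSums b≡window))))
    where
    b≡window : b ≡ factorAt u i' (length a)
    b≡window = trans b≡ (cong (factorAt u i') (sym |a|≡|b|))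

  adjacentSums-reflects-orbits : ∀ {u p q s} → ClosedUnder I₂ u → TwoSteps u →
    IsFactor u p → IsFactor u q → 4 ≤ length p → 4 ≤ length q →
    SameOrbit I₂' s (adjacentSums p) → SameOrbit I₂' s (adjacentSums q) → SameOrbit I₂ p q
  adjacentSums-reflects-orbits {u} {p} {q} closed twoSteps p∈u q∈u 4≤|p| 4≤|q| s∼Sp s∼Sq =
    let ν  , Sνp≡s  = adjacentSums-lift s∼Sp
        ν' , Sν'q≡s = adjacentSums-lift s∼Sq
        Sνp≡Sν'q    = trans Sνp≡s (sym Sν'q≡s)
        |νp|≡|ν'q|  = adjacentSums-length-injective {apply ν p} {apply ν' q} (≤-trans (s≤s z≤n) (long ν {p} 4≤|p|))
                        (≤-trans (s≤s z≤n) (long ν' {q} 4≤|q|)) (cong length Sνp≡Sν'q)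
        t  , eq     = factors-rigid twoSteps (closed ν tt p p∈u) (closed ν' tt q q∈u)
                        |νp|≡|ν'q| (long ν {p} 4≤|p|) Sνp≡Sν'q
    in orbit-trans (ν , tt , refl) (orbit-trans (Π t , tt , eq) (orbit-sym (ν' , tt , refl)))
    where
    long : ∀ ν {w} → 4 ≤ length w → 4 ≤ length (apply ν w)
    long ν {w} = subst (4 ≤_) (sym (length-apply ν w))

module Counting (m : ℕ) .{{_ : NonZero m}} where
  open Z m
  open Letters m
  open Symmetries m
  open AdjacentSums m
  open Factors m
  open Rigidity m

  _⊑?_ : ∀ p w → Dec (p ⊑ w)
  p ⊑? w = map′ (∈-infixes⁻ w) (λ { (xs , ys , refl) → ∈-infixes⁺ xs p ys }) (p ∈? infixes w)
    where open Data.List.Membership.DecPropositional _≟ʷ_ using (_∈?_)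

  palindromeClasses : ∀ w → ∃ λ n → OrbitCount I₂ (PalFactor I₂ w) n
  palindromeClasses w = countClasses orbit-isDecEquivalence (λ p → p ⊑? w ×-dec isPalindrome? p)
    (infixes w) (λ { ((xs , ys , refl) , _) → ∈-infixes⁺ xs _ ys })

  noGammaLetters : ∀ w → OrbitCount I₂ (GammaLetter I₂ w) 0
  noGammaLetters w = (λ ()) , (λ ()) , (λ ()) , λ { _ (a , refl , _ , ¬fixed) →
    ⊥-elim (¬fixed (Ψ (a ⊕ a)) tt tt (cong (_∷ []) (double-⊖ a))) }

  adjacentSums-palindrome : ∀ {w p} → PalFactor I₂ w p → PalFactor I₂' (adjacentSums w) (adjacentSums p)
  adjacentSums-palindrome {p = p} (p⊑w , Ψ c , _ , _ , fixed) = adjacentSums-⊑ p⊑w ,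
    Ψ (c ⊕ c) , (c , sym (double-mod c)) , tt , trans (sym (adjacentSums-apply (Ψ c) p)) (cong adjacentSums fixed)
  adjacentSums-palindrome (_ , Π _ , _ , () , _)

  shortCodes : ℕ
  shortCodes = suc m * (suc m * suc m)

  -- A word of length < 4 is encoded by its first three letters, a missing letter as fzero.
  headSlot : Word → Fin (suc m)
  headSlot []      = fzero
  headSlot (a ∷ _) = fsuc a

  shortCode : Word → Fin shortCodes
  shortCode w = combine (headSlot w) (combine (headSlot (drop 1 w)) (headSlot (drop 1 (drop 1 w))))

  headSlot-drop-injective : ∀ {v w} → headSlot v ≡ headSlot w → drop 1 v ≡ drop 1 w → v ≡ w
  headSlot-drop-injective {[]}    {[]}    _  _  = refl
  headSlot-drop-injective {a ∷ v} {b ∷ w} eq eq′ = cong₂ _∷_ (suc-injective eq) eq′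

  drop-3-short : ∀ (w : Word) → length w < 4 → drop 1 (drop 1 (drop 1 w)) ≡ []
  drop-3-short []                _ = refl
  drop-3-short (_ ∷ [])          _ = refl
  drop-3-short (_ ∷ _ ∷ [])      _ = refl
  drop-3-short (_ ∷ _ ∷ _ ∷ [])  _ = refl
  drop-3-short (_ ∷ _ ∷ _ ∷ _ ∷ _) (s≤s (s≤s (s≤s (s≤s ()))))

  shortCode-injective : ∀ {v w} → length v < 4 → length w < 4 → shortCode v ≡ shortCode w → v ≡ w
  shortCode-injective {v} {w} |v|<4 |w|<4 eq =
    let e₀ , e₁₂ = combine-injective _ _ _ _ eq
        e₁ , e₂  = combine-injective _ _ _ _ e₁₂
    in  headSlot-drop-injective e₀ (headSlot-drop-injective e₁ (headSlot-drop-injective e₂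
          (trans (drop-3-short v |v|<4) (sym (drop-3-short w |w|<4)))))

  palindromeClasses-bound : ∀ {u w N k} → ClosedUnder I₂ u → TwoSteps u → IsFactor u w →
    OrbitCount I₂ (PalFactor I₂ w) N → OrbitCount I₂' (PalFactor I₂' (adjacentSums w)) k →
    N ≤ k + shortCodes
  palindromeClasses-bound {u} {k = k} closed twoSteps w∈u (reps , isPal , distinct , _) (reps' , _ , _ , covers') =
    ⊎-injective⇒≤ (λ i → classify i (4 ≤? length (reps i))) (classify-injective _ _ _ _)
    where
    class' : ∀ i → ∃ λ j → SameOrbit I₂' (reps' j) (adjacentSums (reps i))
    class' i = covers' _ (adjacentSums-palindrome (isPal i))

    classify : ∀ i → Dec (4 ≤ length (reps i)) → Fin k ⊎ Fin shortCodes
    classify i (yes _) = inj₁ (proj₁ (class' i))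
    classify i (no _)  = inj₂ (shortCode (reps i))

    factor : ∀ i → IsFactor u (reps i)
    factor i = infix-isFactor {u} w∈u (proj₁ (isPal i))

    classify-injective : ∀ i j di dj → classify i di ≡ classify j dj → i ≡ j
    classify-injective i j (yes 4≤i) (yes 4≤j) eq = distinct i j
      (adjacentSums-reflects-orbits closed twoSteps (factor i) (factor j) 4≤i 4≤j (proj₂ (class' i))
        (subst (λ c → SameOrbit I₂' (reps' c) (adjacentSums (reps j))) (sym (inj₁-injective eq)) (proj₂ (class' j))))
    classify-injective i j (no i<4) (no j<4) eq = distinct i j
      (subst (SameOrbit I₂ (reps i)) (shortCode-injective (≰⇒> i<4) (≰⇒> j<4) (inj₂-injective eq)) (orbit-refl _))
    classify-injective i j (yes _) (no _) ()
    classify-injective i j (no _) (yes _) ()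

  rich⇒palindromeClasses-≥ : ∀ {u w N} → Rich I₂ u → IsFactor u w → OrbitCount I₂ (PalFactor I₂ w) N →
                             length w + 1 ≤ N
  rich⇒palindromeClasses-≥ rich w∈u count =
    m-n-0≤0⇒m≤n _ _ (rich _ w∈u _ (_ , 0 , count , noGammaLetters _ , refl))

  S-factor-palindromeClasses-≥ : ∀ {u v k} → ClosedUnder I₂ u → TwoSteps u → Rich I₂ u → IsFactor (S u) v →
                                 OrbitCount I₂' (PalFactor I₂' v) k → length v + 1 ≤ k + shortCodes
  S-factor-palindromeClasses-≥ {u} {v} {k} closed twoSteps rich v∈Su count' =
    let w , w∈u , |w|≡1+|v| , Sw≡v = S-factor {u} v∈Su
        N , count = palindromeClasses w
    in begin
      length v + 1     ≡⟨ +-comm (length v) 1 ⟩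
      suc (length v)   ≡⟨ |w|≡1+|v| ⟨
      length w         ≤⟨ m≤m+n (length w) 1 ⟩
      length w + 1     ≤⟨ rich⇒palindromeClasses-≥ {u} rich w∈u count ⟩
      N                ≤⟨ palindromeClasses-bound {u} closed twoSteps w∈u count
                            (subst (λ x → OrbitCount I₂' (PalFactor I₂' x) k) (sym Sw≡v) count') ⟩
      k + shortCodes   ∎
    where open ≤-Reasoning

mainTheorem7 : (m : ℕ) .{{_ : NonZero m}} → 2 ≤ m → (u : Z.InfWord m) →
    Z.ClosedUnder m (Z.I₂ m) u → Z.TwoSteps m u → Z.Rich m (Z.I₂ m) u →
    Z.AlmostRich m (Z.I₂' m) (Z.S m u)
mainTheorem7 m _ u closed twoSteps rich = shortCodes , λ { v v∈Su _ (k , γ , count , _ , refl) →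
  m≤n+o⇒m-n-k≤o (length v + 1) k shortCodes γ (S-factor-palindromeClasses-≥ closed twoSteps rich v∈Su count) }
  where open Counting m
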